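{- Let $\mathcal I$ be an instance of bin packing with conflicts whose item set $I$ is partitioned into sets $G_1,\dots,G_n$ and whose conflict graph is the complete multipartite graph with parts $G_1,\dots,G_n$, with sizes $s:I\to[0,1]$, and suppose that $\mathrm{OPT}(\mathcal I_j)=2$ for every $j\in[n]$, where $\mathcal I_j=(G_j,s)$ is the classical bin packing instance on $G_j$. Let $\mathcal A=(A_1,\dots,A_m)$ be a packing of $\mathcal I$ with $m<1.5\cdot\mathrm{OPT}(\mathcal I)$. Then there is $j\in[n]$ such that $|\mathcal A(G_j)|\le 2$ and $\mathcal A(G_j)$ is a packing of $\mathcal I_j$.
   Context: Bin packing with conflicts: a packing is a partition of the items into bins, each an independent set of the conflict graph with total size at most $1$; $\mathrm{OPT}$ is the minimum number of bins. In a complete multipartite conflict graph each bin contains items from only one part; $\mathcal A(G_j)$ denotes the collection of bins of $\mathcal A$ that contain items of $G_j$, and $|\mathcal A(G_j)|$ its number of bins.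
   Formalization: The item sizes take values in the rationals between 0 and 1 rather than in the real interval $[0,1]$. -}

module Defs where

open import Data.Nat using (ℕ)
open import Data.Fin using (Fin; _≟_)
open import Data.List using (foldr; allFin)
open import Data.Bool using (Bool; true; false; if_then_else_; _∧_; T)
open import Data.Product using (Σ; _×_; ∃)
open import Data.Empty using (⊥)
open import Relation.Nullary using (¬_)
open import Relation.Nullary.Decidable using (⌊_⌋)
open import Relation.Binary.PropositionalEquality using (_≡_; _≢_)
open import Function.Definitions using (Injective)
open import Data.Rational using (ℚ; 0ℚ; 1ℚ; _+_; _≤_)

-- A bin packing with conflicts instance has items Fin N (restricted to those
-- with `items i = true`), sizes `size`, and a conflict relation `conflict`.

load : {N m : ℕ} → (items : Fin N → Bool) → (size : Fin N → ℚ) →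
       (f : Fin N → Fin m) → Fin m → ℚ
load items size f b =
  foldr (λ i acc → if items i ∧ ⌊ f i ≟ b ⌋ then size i + acc else acc) 0ℚ (allFin _)

-- f is a packing into exactly m bins: the bins partition the item set
-- (every bin nonempty), each bin is an independent set of the conflict
-- graph, and each bin has total size at most 1.
IsPacking : {N : ℕ} → (items : Fin N → Bool) → (conflict : Fin N → Fin N → Set) →
            (size : Fin N → ℚ) → (m : ℕ) → (Fin N → Fin m) → Set
IsPacking items conflict size m f =
  (∀ b → Σ (Fin _) (λ i → T (items i) × f i ≡ b)) ×
  (∀ i k → T (items i) → T (items k) → f i ≡ f k → ¬ conflict i k) ×
  (∀ b → load items size f b ≤ 1ℚ)

IsOPT : {N : ℕ} → (items : Fin N → Bool) → (conflict : Fin N → Fin N → Set) →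
        (size : Fin N → ℚ) → ℕ → Set
IsOPT items conflict size k =
  Σ (Fin _ → Fin k) (IsPacking items conflict size k) ×
  (∀ m (f : Fin _ → Fin m) → IsPacking items conflict size m f → Data.Nat._≤_ k m)

allItems : {N : ℕ} → Fin N → Bool
allItems _ = true

inPart : {N n : ℕ} → (Fin N → Fin n) → Fin n → Fin N → Bool
inPart part j i = ⌊ part i ≟ j ⌋

multipartite : {N n : ℕ} → (Fin N → Fin n) → Fin N → Fin N → Set
multipartite part i k = part i ≢ part k

noConflict : {N : ℕ} → Fin N → Fin N → Set
noConflict _ _ = ⊥

InA : {N n m : ℕ} → (Fin N → Fin n) → (Fin N → Fin m) → Fin n → Fin m → Set
InA part f j b = Σ (Fin _) (λ i → part i ≡ j × f i ≡ b)

-- 𝒜(G_j) consists of exactly c bins (enumerated injectively by e), and these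
-- bins, renumbered via e, form a packing g of the classical instance 𝓘_j
-- (in particular they contain only items of G_j).
AGjPackingWith : {N n m : ℕ} → (part : Fin N → Fin n) → (size : Fin N → ℚ) →
                 (f : Fin N → Fin m) → Fin n → (c : ℕ) → Set
AGjPackingWith part size f j c =
  Σ (Fin c → Fin _) λ e →
    Injective _≡_ _≡_ e ×
    (∀ b → InA part f j b → ∃ λ k → e k ≡ b) ×
    (∀ k → InA part f j (e k)) ×
    (∀ i → (∃ λ k → e k ≡ f i) → part i ≡ j) ×
    Σ (Fin _ → Fin c) λ g →
      (∀ i → part i ≡ j → e (g i) ≡ f i) ×
      IsPacking (inPart part j) noConflict size c g

{-# OPTIONS --safe #-}
-- Gluing optimal two-bin packings of the parts packs the whole instance into 2n bins,
-- so OPT ≤ 2n. Every bin of 𝒜 holds items of a single part, so if every part met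
-- at least three bins of 𝒜 we would get m ≥ 3n ≥ 1.5 OPT. Hence some part G_j meets
-- at most two bins, and those bins, restricted to G_j, pack 𝓘_j.
module Submission where

open import Defs
open import Data.Nat using (ℕ; _*_; _<_; _≤_)
open import Data.Fin using (Fin)
open import Data.Product using (Σ; _×_; ∃)
open import Data.Rational using (ℚ; 0ℚ; 1ℚ)
import Data.Rational as Q

import Data.Nat as ℕ
open import Data.Nat using (_≤?_)
open import Data.Nat.Properties using (*-monoʳ-≤; *-cancelˡ-<; ≰⇒>; <⇒≱; module ≤-Reasoning)
open import Data.Nat.Tactic.RingSolver using (solve-∀)
open import Data.Fin using (zero; suc; _≟_; combine; remQuot; inject≤)
open import Data.Fin.Properties
  using (combine-injective; combine-remQuot; inject≤-injective; injective⇒≤; any?)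
open import Data.Product using (_,_; proj₁; proj₂; uncurry)
open import Data.List using (List; foldr; allFin; filter; length; lookup)
open import Data.List.Properties using (foldr-cong)
import Data.List.Relation.Unary.All as All
open import Data.List.Relation.Unary.AllPairs using (_∷_)
open import Data.List.Relation.Unary.Any using (index)
open import Data.List.Relation.Unary.Any.Properties using (lookup-index)
open import Data.List.Relation.Unary.Unique.Propositional using (Unique)
open import Data.List.Relation.Unary.Unique.Propositional.Properties using (filter⁺; allFin⁺)
open import Data.List.Membership.Propositional using (_∈_)
open import Data.List.Membership.Propositional.Properties
  using (∈-filter⁺; ∈-filter⁻; ∈-allFin; ∈-lookup)
open import Data.Bool using (Bool; if_then_else_; _∧_; T)
open import Data.Unit using (tt)
open import Relation.Nullary using (¬_; Dec; yes; no; does; _×-dec_; contradiction)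
open import Relation.Nullary.Decidable
  using (⌊_⌋; T?; isYes≗does; does-⇔; decidable-stable; toWitness; fromWitness)
open import Relation.Binary.PropositionalEquality
  using (_≡_; refl; sym; trans; cong; subst; module ≡-Reasoning)
open import Function.Bundles using (_⇔_; mk⇔; Equivalence)
open import Function.Base using (_∘_; case_of_)
open import Function.Definitions using (Injective)

lookup-injective : {A : Set} {xs : List A} → Unique xs → Injective _≡_ _≡_ (lookup xs)
lookup-injective (x∉xs ∷ u) {zero}  {zero}  eq = refl
lookup-injective (x∉xs ∷ u) {zero}  {suc j} eq = contradiction eq (All.lookup x∉xs (∈-lookup j))
lookup-injective (x∉xs ∷ u) {suc i} {zero}  eq = contradiction (sym eq) (All.lookup x∉xs (∈-lookup i))
lookup-injective (x∉xs ∷ u) {suc i} {suc j} eq = cong suc (lookup-injective u eq)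

⌊⌋-∧-does : {A : Set} (x : Bool) (a? : Dec A) → x ∧ ⌊ a? ⌋ ≡ does (T? x ×-dec a?)
⌊⌋-∧-does x a? = cong (x ∧_) (isYes≗does a?)

load-cong : {N m m′ : ℕ} {items items′ : Fin N → Bool} (size : Fin N → ℚ)
            {f : Fin N → Fin m} {f′ : Fin N → Fin m′} {b : Fin m} {b′ : Fin m′} →
            (∀ i → (T (items i) × f i ≡ b) ⇔ (T (items′ i) × f′ i ≡ b′)) →
            load items size f b ≡ load items′ size f′ b′
load-cong {N} {items = items} {items′} size {f} {f′} {b} {b′} sameContents =
  foldr-cong (λ i acc → cong (λ t → if t then size i Q.+ acc else acc) (inBin-cong i))
             refl (allFin N)
  where
  open ≡-Reasoning
  inBin-cong : ∀ i → items i ∧ ⌊ f i ≟ b ⌋ ≡ items′ i ∧ ⌊ f′ i ≟ b′ ⌋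
  inBin-cong i = begin
    items i ∧ ⌊ f i ≟ b ⌋       ≡⟨ ⌊⌋-∧-does (items i) (f i ≟ b) ⟩
    does inBin?                 ≡⟨ does-⇔ (sameContents i) inBin? inBin′? ⟩
    does inBin′?                ≡⟨ ⌊⌋-∧-does (items′ i) (f′ i ≟ b′) ⟨
    items′ i ∧ ⌊ f′ i ≟ b′ ⌋    ∎
    where
    inBin?  = T? (items i) ×-dec (f i ≟ b)
    inBin′? = T? (items′ i) ×-dec (f′ i ≟ b′)

module _ {m n : ℕ} (h : Fin m → Fin n) where

  fibre : Fin n → List (Fin m)
  fibre j = filter (λ b → h b ≟ j) (allFin m)

  fibre-unique : ∀ j → Unique (fibre j)
  fibre-unique j = filter⁺ (λ b → h b ≟ j) (allFin⁺ m)

  ∈-fibre⁺ : ∀ {j b} → h b ≡ j → b ∈ fibre j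
  ∈-fibre⁺ {j} {b} = ∈-filter⁺ (λ b → h b ≟ j) (∈-allFin b)

  ∈-fibre⁻ : ∀ {j b} → b ∈ fibre j → h b ≡ j
  ∈-fibre⁻ {j} b∈ = proj₂ (∈-filter⁻ (λ b → h b ≟ j) {xs = allFin m} b∈)

  lookup-fibre : ∀ j k → h (lookup (fibre j) k) ≡ j
  lookup-fibre j k = ∈-fibre⁻ (∈-lookup k)

  large-fibres⇒≤ : ∀ {k} → (∀ j → k ≤ length (fibre j)) → n * k ≤ m
  large-fibres⇒≤ {k} large =
    injective⇒≤ {f = uncurry pick ∘ remQuot {n} k} pick∘remQuot-injective
    where
    pick : Fin n → Fin k → Fin m
    pick j t = lookup (fibre j) (inject≤ t (large j))

    pick-injective : ∀ {j j′ t t′} → pick j t ≡ pick j′ t′ → (j , t) ≡ (j′ , t′)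
    pick-injective {j} {j′} {t} {t′} eq
      with refl ← trans (sym (lookup-fibre j _)) (trans (cong h eq) (lookup-fibre j′ _))
      = cong (j ,_) (inject≤-injective _ _ t t′ (lookup-injective (fibre-unique j) eq))

    pick∘remQuot-injective : Injective _≡_ _≡_ (uncurry pick ∘ remQuot {n} k)
    pick∘remQuot-injective {x} {y} eq = begin
      x                                  ≡⟨ combine-remQuot {n} k x ⟨
      uncurry combine (remQuot {n} k x)  ≡⟨ cong (uncurry combine) (pick-injective eq) ⟩
      uncurry combine (remQuot {n} k y)  ≡⟨ combine-remQuot {n} k y ⟩
      y                                  ∎
      where open ≡-Reasoning

module _ {N n k : ℕ} {part : Fin N → Fin n} {size : Fin N → ℚ} where

  glue : (Fin n → Fin N → Fin k) → Fin N → Fin (n * k)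
  glue g i = combine (part i) (g (part i) i)

  glue-isPacking : (g : Fin n → Fin N → Fin k) →
                   (∀ j → IsPacking (inPart part j) noConflict size k (g j)) →
                   IsPacking allItems (multipartite part) size (n * k) (glue g)
  glue-isPacking g packs = nonempty , independent , fits
    where
    glue-≡ : ∀ {i j t} → part i ≡ j → g j i ≡ t → glue g i ≡ combine j t
    glue-≡ refl refl = refl

    inGluedBin⇔ : ∀ j t i → (T (allItems i) × glue g i ≡ combine j t) ⇔
                             (T (inPart part j i) × g j i ≡ t)
    inGluedBin⇔ j t i = mk⇔ to from
      where
      to : T (allItems i) × glue g i ≡ combine j t → T (inPart part j i) × g j i ≡ t
      to (_ , eq) with refl , gi≡t ← combine-injective (part i) _ j t eq = fromWitness refl , gi≡t
      from : T (inPart part j i) × g j i ≡ t → T (allItems i) × glue g i ≡ combine j t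
      from (i∈Gj , gi≡t) = tt , glue-≡ (toWitness i∈Gj) gi≡t

    onCombined : {P : Fin (n * k) → Set} → (∀ j t → P (combine j t)) → ∀ x → P x
    onCombined {P} p x = subst P (combine-remQuot {n} k x) (uncurry p (remQuot {n} k x))

    nonempty : ∀ x → Σ (Fin N) λ i → T (allItems i) × glue g i ≡ x
    nonempty = onCombined λ j t →
      let i , i∈Gj , gi≡t = proj₁ (packs j) t in i , tt , glue-≡ (toWitness i∈Gj) gi≡t

    independent : ∀ i i′ → T (allItems i) → T (allItems i′) → glue g i ≡ glue g i′ →
                  ¬ multipartite part i i′
    independent i i′ _ _ eq = contradiction (proj₁ (combine-injective _ _ _ _ eq))

    fits : ∀ x → load allItems size (glue g) x Q.≤ 1ℚ
    fits = onCombined λ j t →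
      subst (Q._≤ 1ℚ) (sym (load-cong size (inGluedBin⇔ j t))) (proj₂ (proj₂ (packs j)) t)

  opt-≤-parts : ∀ {opt} → IsOPT allItems (multipartite part) size opt →
                (∀ j → IsOPT (inPart part j) noConflict size k) → opt ≤ n * k
  opt-≤-parts (_ , minimal) optParts =
    minimal (n * k) (glue g) (glue-isPacking g (λ j → proj₂ (proj₁ (optParts j))))
    where
    g : Fin n → Fin N → Fin k
    g j = proj₁ (proj₁ (optParts j))

module BinsOfPart {N n m : ℕ} {part : Fin N → Fin n} {size : Fin N → ℚ} {f : Fin N → Fin m}
                  (packing : IsPacking allItems (multipartite part) size m f) where

  witness : Fin m → Fin N
  witness b = proj₁ (proj₁ packing b)

  f-witness : ∀ b → f (witness b) ≡ b
  f-witness b = proj₂ (proj₂ (proj₁ packing b))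

  binPart : Fin m → Fin n
  binPart b = part (witness b)

  part≡binPart : ∀ i → part i ≡ binPart (f i)
  part≡binPart i = decidable-stable (part i ≟ binPart (f i))
    (proj₁ (proj₂ packing) i (witness (f i)) tt tt (sym (f-witness (f i))))

  part≡binPart-of : ∀ {i b} → f i ≡ b → part i ≡ binPart b
  part≡binPart-of refl = part≡binPart _

  module _ (j : Fin n) (i₀ : Fin N) (i₀∈Gj : part i₀ ≡ j) where

    #bins : ℕ
    #bins = length (fibre binPart j)

    bin : Fin #bins → Fin m
    bin = lookup (fibre binPart j)

    bin-injective : Injective _≡_ _≡_ bin
    bin-injective = lookup-injective (fibre-unique binPart j)

    binPart-bin : ∀ t → binPart (bin t) ≡ j
    binPart-bin = lookup-fibre binPart j

    indexOf : ∀ {b} → binPart b ≡ j → Fin #bins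
    indexOf b∈ = index (∈-fibre⁺ binPart b∈)

    bin-indexOf : ∀ {b} (b∈ : binPart b ≡ j) → bin (indexOf b∈) ≡ b
    bin-indexOf b∈ = sym (lookup-index (∈-fibre⁺ binPart b∈))

    binOf : ∀ {i} → part i ≡ j → binPart (f i) ≡ j
    binOf {i} = trans (sym (part≡binPart i))

    -- Items outside G_j are sent to the bin of i₀; IsPacking (inPart part j) ignores them.
    restrict : Fin N → Fin #bins
    restrict i with part i ≟ j
    ... | yes i∈Gj = indexOf (binOf i∈Gj)
    ... | no _     = indexOf (binOf i₀∈Gj)

    bin-restrict : ∀ i → part i ≡ j → bin (restrict i) ≡ f i
    bin-restrict i i∈Gj with part i ≟ j
    ... | yes i∈Gj′ = bin-indexOf (binOf i∈Gj′)
    ... | no i∉Gj   = contradiction i∈Gj i∉Gj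

    inRestrictedBin⇔ : ∀ t i → (T (inPart part j i) × restrict i ≡ t) ⇔
                               (T (allItems i) × f i ≡ bin t)
    inRestrictedBin⇔ t i = mk⇔ to from
      where
      to : T (inPart part j i) × restrict i ≡ t → T (allItems i) × f i ≡ bin t
      to (i∈Gj , refl) = tt , sym (bin-restrict i (toWitness i∈Gj))
      from : T (allItems i) × f i ≡ bin t → T (inPart part j i) × restrict i ≡ t
      from (_ , fi≡bin) = fromWitness i∈Gj , bin-injective (trans (bin-restrict i i∈Gj) fi≡bin)
        where
        i∈Gj : part i ≡ j
        i∈Gj = trans (part≡binPart-of fi≡bin) (binPart-bin t)

    restrict-isPacking : IsPacking (inPart part j) noConflict size #bins restrict
    restrict-isPacking = nonempty , (λ _ _ _ _ _ ()) , fits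
      where
      nonempty : ∀ t → Σ (Fin N) λ i → T (inPart part j i) × restrict i ≡ t
      nonempty t = witness (bin t) ,
        Equivalence.from (inRestrictedBin⇔ t (witness (bin t))) (tt , f-witness (bin t))

      fits : ∀ t → load (inPart part j) size restrict t Q.≤ 1ℚ
      fits t = subst (Q._≤ 1ℚ) (sym (load-cong size (inRestrictedBin⇔ t)))
                     (proj₂ (proj₂ packing) (bin t))

    bins-AGjPacking : AGjPackingWith part size f j #bins
    bins-AGjPacking =
        bin
      , bin-injective
      , (λ { b (i , i∈Gj , refl) → indexOf (binOf i∈Gj) , bin-indexOf (binOf i∈Gj) })
      , (λ t → witness (bin t) , binPart-bin t , f-witness (bin t))
      , (λ { i (t , bin≡fi) → trans (part≡binPart-of (sym bin≡fi)) (binPart-bin t) })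
      , restrict , bin-restrict , restrict-isPacking

part-nonempty : ∀ {N n k} {part : Fin N → Fin n} {size : Fin N → ℚ} {j} →
                IsOPT (inPart part j) noConflict size (ℕ.suc k) → ∃ λ i → part i ≡ j
part-nonempty ((_ , nonempty , _) , _) with i , i∈Gj , _ ← nonempty zero = i , toWitness i∈Gj

m<n*3 : ∀ {m n opt} → 2 * m < 3 * opt → opt ≤ n * 2 → m < n * 3
m<n*3 {m} {n} {opt} 2m<3opt opt≤2n = *-cancelˡ-< 2 m (n * 3) (begin-strict
  2 * m        <⟨ 2m<3opt ⟩
  3 * opt      ≤⟨ *-monoʳ-≤ 3 opt≤2n ⟩
  3 * (n * 2)  ≡⟨ reassociate n ⟩
  2 * (n * 3)  ∎)
  where
  open ≤-Reasoning
  reassociate : ∀ n → 3 * (n * 2) ≡ 2 * (n * 3)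
  reassociate = solve-∀

lemma24 : (N n : ℕ) (part : Fin N → Fin n) (size : Fin N → ℚ) →
    (∀ i → 0ℚ Q.≤ size i × size i Q.≤ 1ℚ) →
    (∀ j → IsOPT (inPart part j) noConflict size 2) →
    (m : ℕ) (f : Fin N → Fin m) →
    IsPacking allItems (multipartite part) size m f →
    (opt : ℕ) → IsOPT allItems (multipartite part) size opt →
    2 * m < 3 * opt →
    ∃ λ j → Σ ℕ λ c → c ≤ 2 × AGjPackingWith part size f j c
lemma24 N n part size _ optParts m f packing opt optAll 2m<3opt =
  case any? (λ j → length (fibre binPart j) ≤? 2) of λ where
    (yes (j , few)) →
      j , _ , few , uncurry (bins-AGjPacking j) (part-nonempty {size = size} (optParts j))
    (no ¬few) →
      contradiction (large-fibres⇒≤ binPart (λ j → ≰⇒> (λ few → ¬few (j , few))))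
                    (<⇒≱ (m<n*3 {n = n} 2m<3opt (opt-≤-parts {size = size} optAll optParts)))
  where open BinsOfPart {size = size} packing
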